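{- For $n\ge 0$ let $K_n=\kappa_{n+1}/(n+1)$, where $\kappa_{n+1}$ is the number of kernel positions of rank $n+1$ in the flat Bernoulli game. Then $K_n$ is the number of kernel positions of rank $n$ in the exception-free variant of the flat Bernoulli game.
   Context: The flat Bernoulli game: positions are words $u_1\cdots u_n$ ($n\ge0$) of positive integers with $1\le u_i\le i$; a valid move replaces $u_1\cdots u_n$ by $u_1\cdots u_m$ for some $1\le m<n$ such that $u_{m+1}<u_j$ for all $j>m+1$. The exception-free variant has the same positions (the empty word included), and a valid move replaces $u_1\cdots u_n$ by $u_1\cdots u_m$ for some $0\le m<n$ such that $u_{m+1}<u_j$ for all $j>m+1$ (so removing the entire word is allowed when $u_1<u_2,\ldots,u_n$). In both games players alternate, a player unable to move loses, and kernel positions are positions of Grundy number zero (every valid move from them leads to a non-kernel position). -}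

module Defs where

open import Data.Nat using (ℕ; zero; suc; _<ᵇ_; _≤ᵇ_)
open import Data.Fin using (Fin; toℕ)
open import Data.Bool using (Bool; true; false; not; _∨_; _∧_)
open import Data.List using (List; []; _∷_; _++_; [_]; length; map; concatMap; allFin; upTo; take; drop; filterᵇ; foldr)

allᵇ : {A : Set} → (A → Bool) → List A → Bool
allᵇ p = foldr (λ x b → p x ∧ b) true

-- Positions of rank n: words u₁ ⋯ uₙ with 1 ≤ uᵢ ≤ i, built letter by letter.
-- The letter k : Fin (suc n) appended at position n+1 stands for the value toℕ k + 1 ∈ {1,…,n+1}.
data Word : ℕ → Set where
  []  : Word 0
  _▷_ : ∀ {n} → Word n → Fin (suc n) → Word (suc n)

toList : ∀ {n} → Word n → List ℕ
toList []      = []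
toList (w ▷ k) = toList w ++ [ suc (toℕ k) ]

allWords : (n : ℕ) → List (Word n)
allWords zero    = [ [] ]
allWords (suc n) = concatMap (λ w → map (w ▷_) (allFin (suc n))) (allWords n)

-- The condition u_{m+1} < u_j for all j > m+1, for the move u₁⋯uₙ ↦ u₁⋯uₘ (m < n).
moveCondition : List ℕ → ℕ → Bool
moveCondition u m with drop m u
... | []     = false
... | x ∷ xs = allᵇ (x <ᵇ_) xs

-- Kernel (Grundy number zero) positions of the game whose moves are u ↦ u₁⋯uₘ
-- with lo ≤ m < length u and moveCondition u m.
-- lo = 1 : flat Bernoulli game;  lo = 0 : exception-free variant.
-- Defined by recursion on a fuel argument f ≥ length u (moves strictly shorten the word);
-- with fuel zero the word is empty and has no moves, hence is a kernel position.
isKernelFuel : ℕ → ℕ → List ℕ → Bool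
isKernelFuel lo zero    u = true
isKernelFuel lo (suc f) u =
  allᵇ (λ m → not (lo ≤ᵇ m) ∨ not (moveCondition u m) ∨ not (isKernelFuel lo f (take m u)))
      (upTo (length u))

isKernel : ℕ → List ℕ → Bool
isKernel lo u = isKernelFuel lo (length u) u

kernelCount : ℕ → ℕ → ℕ
kernelCount lo n = length (filterᵇ (λ w → isKernel lo (toList w)) (allWords n))

κ : ℕ → ℕ
κ = kernelCount 1

κEF : ℕ → ℕ
κEF = kernelCount 0

module Submission where

-- A position is a kernel position iff it has no winning move (a valid move to a kernel
-- prefix).  Such a move, if it exists, is unique and can be tracked letter by letter, so kernel
-- positions are recognised by an automaton with states `nothing` (kernel) and `just m` (the
-- winning move leads to a prefix followed by the letter m+1): reading v+1, `just m` survives iff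
-- m < v, and `nothing` becomes `just v` when the move deleting the new letter is allowed.
-- Counting accepted runs, and noting that every move is allowed from length 0 in the
-- exception-free variant and from length 1 in the flat game (whose first letter is always 1),
--   κEF n = fromKernel 0 n   and   κ (n+1) = fromKernel 1 n,
-- where fromKernel t r counts the ways to append r letters to a kernel position of length t and
-- end at a kernel position.  A simultaneous induction with binomially weighted sums over the
-- non-kernel states gives fromKernel t r = (t+r choose r)·K r with K independent of t, whence
-- κ (n+1) = (n+1)·κEF n.

open import Defs
open import Data.Nat using (ℕ; suc; _*_)
open import Relation.Binary.PropositionalEquality using (_≡_)

open import Data.Bool using (Bool; true; false; not; _∧_; _∨_; if_then_else_)
open import Data.Bool.Properties using (∧-assoc; ∧-comm; ∧-identityʳ; ∧-zeroʳ; T-≡; if-float)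
open import Data.Fin using (Fin; toℕ; zero; suc; inject₁; fromℕ)
open import Data.Fin.Properties using (toℕ<n; toℕ-inject₁; toℕ-fromℕ)
open import Data.List
  using (List; []; _∷_; _++_; [_]; _∷ʳ_; length; map; upTo; take; allFin; tabulate; concatMap; filterᵇ)
open import Data.List.Properties using (applyUpTo-∷ʳ; length-++; length-take; take-all; map-cong; map-++; map-∘)
open import Data.Maybe using (Maybe; just; nothing; is-nothing)
open import Data.Nat using (zero; _+_; _∸_; _≤_; _<_; _≤ᵇ_; _<ᵇ_; _≟_; _≤?_; _!; _/_; z≤n; s≤s; NonZero)
open import Data.Nat.Combinatorics
  using (_C_; nCk+nC[k+1]≡[n+1]C[k+1]; k>n⇒nCk≡0; nCn≡1; nC1≡n; nCk≡nC[n∸k]; nCk≡n!/k![n-k]!; k![n∸k]!∣n!)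
open import Data.Nat.DivMod using (m/n*n≡m)
open import Data.Nat.ListAction using () renaming (sum to listSum)
open import Data.Nat.ListAction.Properties using (sum-++)
open import Data.Nat.Properties
open import Algebra.Properties.Semiring.Sum +-*-semiring
  using (sum-syntax; sum-cong-≗; ∑-distrib-+; *-distribˡ-sum; *-distribʳ-sum; sum-init-last)
open import Data.Nat.Tactic.RingSolver using (solve-∀)
open import Data.Product using (_,_)
open import Data.Sum using (_⊎_; inj₁; inj₂; [_,_]′)
open import Function using (_∘′_)
open import Function.Bundles using (Equivalence)
open import Relation.Binary.PropositionalEquality using (refl; sym; trans; cong; cong₂; subst; _≢_; module ≡-Reasoning)
open import Relation.Nullary using (yes; no; contradiction)

open ≡-Reasoning

pascal : ∀ n k → suc n C suc k ≡ n C k + n C suc k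
pascal n k = sym (nCk+nC[k+1]≡[n+1]C[k+1] n k)

[1+n]Cn≡1+n : ∀ n → suc n C n ≡ suc n
[1+n]Cn≡1+n n = begin
  suc n C n            ≡⟨ nCk≡nC[n∸k] (n≤1+n n) ⟩
  suc n C (suc n ∸ n)  ≡⟨ cong (suc n C_) (m+n∸n≡m 1 n) ⟩
  suc n C 1            ≡⟨ nC1≡n (suc n) ⟩
  suc n                ∎

absorption : ∀ s k → (s C k) * suc s ≡ suc k * (suc s C suc k)
absorption zero    zero    = refl
absorption zero    (suc k) = sym (*-zeroʳ (suc (suc k)))
absorption (suc s) zero    = begin
  1 * suc (suc s)         ≡⟨ *-identityˡ (suc (suc s)) ⟩
  suc (suc s)             ≡⟨ nC1≡n (suc (suc s)) ⟨
  suc (suc s) C 1         ≡⟨ *-identityˡ (suc (suc s) C 1) ⟨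
  1 * (suc (suc s) C 1)   ∎
absorption (suc s) (suc k) = begin
  w * suc (suc s)
    ≡⟨ *-suc w (suc s) ⟩
  w + w * suc s
    ≡⟨ cong (λ c → w + c * suc s) (pascal s k) ⟩
  w + (x + y) * suc s
    ≡⟨ cong (w +_) (*-distribʳ-+ (suc s) x y) ⟩
  w + ((x * suc s) + (y * suc s))
    ≡⟨ cong₂ (λ a b → w + (a + b)) (absorption s k) (absorption s (suc k)) ⟩
  w + (suc k * w + suc (suc k) * z)
    ≡⟨ collect k w z ⟩
  suc (suc k) * (w + z)
    ≡⟨ cong (suc (suc k) *_) (pascal (suc s) (suc k)) ⟨
  suc (suc k) * (suc (suc s) C suc (suc k))
    ∎
  where
  w = suc s C suc k
  x = s C k
  y = s C suc k
  z = suc s C suc (suc k)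
  collect : ∀ k w z → w + (suc k * w + suc (suc k) * z) ≡ suc (suc k) * (w + z)
  collect = solve-∀

binomial-factorials : ∀ a b → ((a + b) C a) * (a ! * b !) ≡ (a + b) !
binomial-factorials a b = begin
  ((a + b) C a) * (a ! * b !)
    ≡⟨ cong (λ c → ((a + b) C a) * (a ! * c !)) (m+n∸m≡n a b) ⟨
  ((a + b) C a) * (a ! * (a + b ∸ a) !)
    ≡⟨ cong (_* (a ! * (a + b ∸ a) !)) (nCk≡n!/k![n-k]! (m≤m+n a b)) ⟩
  ((a + b) ! / (a ! * (a + b ∸ a) !)) {{a !* (a + b ∸ a) !≢0}} * (a ! * (a + b ∸ a) !)
    ≡⟨ m/n*n≡m {{a !* (a + b ∸ a) !≢0}} (k![n∸k]!∣n! (m≤m+n a b)) ⟩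
  (a + b) !
    ∎

trinomial-sum : ∀ a b c →
  ((a + (b + c)) C a) * ((b + c) C b) ≡ ((a + (b + c)) C (a + b)) * ((a + b) C a)
trinomial-sum a b c = *-cancelʳ-≡ _ _ (a ! * b ! * c !) {{a!b!c!≢0}} (begin
    ((a + (b + c)) C a) * ((b + c) C b) * (a ! * b ! * c !)
  ≡⟨ regroupˡ ((a + (b + c)) C a) ((b + c) C b) (a !) (b !) (c !) ⟩
    ((a + (b + c)) C a) * (a ! * (((b + c) C b) * (b ! * c !)))
  ≡⟨ cong (λ z → ((a + (b + c)) C a) * (a ! * z)) (binomial-factorials b c) ⟩
    ((a + (b + c)) C a) * (a ! * (b + c) !)
  ≡⟨ binomial-factorials a (b + c) ⟩
    (a + (b + c)) !
  ≡⟨ cong _! (+-assoc a b c) ⟨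
    ((a + b) + c) !
  ≡⟨ binomial-factorials (a + b) c ⟨
    (((a + b) + c) C (a + b)) * ((a + b) ! * c !)
  ≡⟨ cong (λ n → (n C (a + b)) * ((a + b) ! * c !)) (+-assoc a b c) ⟩
    ((a + (b + c)) C (a + b)) * ((a + b) ! * c !)
  ≡⟨ cong (λ z → ((a + (b + c)) C (a + b)) * (z * c !)) (binomial-factorials a b) ⟨
    ((a + (b + c)) C (a + b)) * ((((a + b) C a) * (a ! * b !)) * c !)
  ≡⟨ regroupʳ ((a + (b + c)) C (a + b)) ((a + b) C a) (a !) (b !) (c !) ⟩
    ((a + (b + c)) C (a + b)) * ((a + b) C a) * (a ! * b ! * c !)
  ∎)
  where
  a!b!c!≢0 : NonZero (a ! * b ! * c !)
  a!b!c!≢0 = m*n≢0 _ _ {{a !* b !≢0}} {{c !≢0}}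
  regroupˡ : ∀ x y p q r → x * y * (p * q * r) ≡ x * (p * (y * (q * r)))
  regroupˡ = solve-∀
  regroupʳ : ∀ x y p q r → x * ((y * (p * q)) * r) ≡ x * y * (p * q * r)
  regroupʳ = solve-∀

-- Trinomial revision for arbitrary b (both sides vanish when b > m).
trinomial : ∀ a m b → ((a + m) C a) * (m C b) ≡ ((a + m) C (a + b)) * ((a + b) C a)
trinomial a m b with b ≤? m
... | yes b≤m with m≤n⇒∃[o]m+o≡n b≤m
...   | c , refl = trinomial-sum a b c
trinomial a m b | no b≰m = begin
    ((a + m) C a) * (m C b)             ≡⟨ cong (((a + m) C a) *_) (k>n⇒nCk≡0 m<b) ⟩
    ((a + m) C a) * 0                   ≡⟨ *-zeroʳ ((a + m) C a) ⟩
    0                                   ≡⟨ cong (_* ((a + b) C a)) (k>n⇒nCk≡0 (+-monoʳ-< a m<b)) ⟨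
    ((a + m) C (a + b)) * ((a + b) C a) ∎
  where
  m<b : m < b
  m<b = ≰⇒> b≰m

hockey-stick : ∀ k t → ∑[ m < t ] ((t ∸ suc (toℕ m)) C k) ≡ t C suc k
hockey-stick k zero    = refl
hockey-stick k (suc t) = trans (cong (t C k +_) (hockey-stick k t)) (sym (pascal t k))

weighted-hockey-stick : ∀ k t → ∑[ m < t ] (((t ∸ suc (toℕ m)) C k) * suc (toℕ m)) ≡ suc t C suc (suc k)
weighted-hockey-stick k zero    = refl
weighted-hockey-stick k (suc t) = begin
    (t C k) * 1 + ∑[ m < t ] (c m * suc (suc (toℕ m)))
  ≡⟨ cong ((t C k) * 1 +_) (sum-cong-≗ (λ m → *-suc (c m) (suc (toℕ m)))) ⟩
    (t C k) * 1 + ∑[ m < t ] (c m + c m * suc (toℕ m))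
  ≡⟨ cong ((t C k) * 1 +_) (∑-distrib-+ c (λ m → c m * suc (toℕ m))) ⟩
    (t C k) * 1 + (∑[ m < t ] c m + ∑[ m < t ] (c m * suc (toℕ m)))
  ≡⟨ cong₂ (λ p q → (t C k) * 1 + (p + q)) (hockey-stick k t) (weighted-hockey-stick k t) ⟩
    (t C k) * 1 + (t C suc k + suc t C suc (suc k))
  ≡⟨ regroup (t C k) (t C suc k) (suc t C suc (suc k)) ⟩
    (t C k + t C suc k) + suc t C suc (suc k)
  ≡⟨ cong (_+ suc t C suc (suc k)) (pascal t k) ⟨
    suc t C suc k + suc t C suc (suc k)
  ≡⟨ pascal (suc t) (suc k) ⟨
    suc (suc t) C suc (suc k)
  ∎
  where
  c : Fin t → ℕ
  c m = (t ∸ suc (toℕ m)) C k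
  regroup : ∀ x y z → x * 1 + (y + z) ≡ (x + y) + z
  regroup = solve-∀

∑-const : ∀ n a → ∑[ i < n ] a ≡ n * a
∑-const zero    a = refl
∑-const (suc n) a = cong (a +_) (∑-const n a)

-- Among the letters 1,…,n+1, exactly n-m exceed m+1 and m+1 do not.
∑-threshold : ∀ {n m} a b → m ≤ n →
  ∑[ v < suc n ] (if m <ᵇ toℕ v then a else b) ≡ (n ∸ m) * a + suc m * b
∑-threshold {n} {zero} a b _ = trans (cong (b +_) (∑-const n a)) (regroup n a b)
  where
  regroup : ∀ n a b → b + n * a ≡ n * a + 1 * b
  regroup = solve-∀
∑-threshold {suc n} {suc m} a b (s≤s m≤n) =
  trans (cong (b +_) (∑-threshold a b m≤n)) (regroup (n ∸ m) a b m)
  where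
  regroup : ∀ x a b m → b + (x * a + suc m * b) ≡ x * a + suc (suc m) * b
  regroup = solve-∀

-- allBelow n p = p 0 ∧ ⋯ ∧ p (n-1), associated to the left so that it grows at the right end.
allBelow : ℕ → (ℕ → Bool) → Bool
allBelow zero    p = true
allBelow (suc n) p = allBelow n p ∧ p n

allᵇ-++ : ∀ {A : Set} (p : A → Bool) xs ys → allᵇ p (xs ++ ys) ≡ allᵇ p xs ∧ allᵇ p ys
allᵇ-++ p []       ys = refl
allᵇ-++ p (x ∷ xs) ys = trans (cong (p x ∧_) (allᵇ-++ p xs ys)) (sym (∧-assoc (p x) _ _))

allᵇ-upTo : ∀ n p → allᵇ p (upTo n) ≡ allBelow n p
allᵇ-upTo zero    p = refl
allᵇ-upTo (suc n) p = begin
    allᵇ p (upTo (suc n))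
  ≡⟨ cong (allᵇ p) (applyUpTo-∷ʳ (λ x → x) n) ⟨
    allᵇ p (upTo n ++ [ n ])
  ≡⟨ allᵇ-++ p (upTo n) [ n ] ⟩
    allᵇ p (upTo n) ∧ (p n ∧ true)
  ≡⟨ cong₂ _∧_ (allᵇ-upTo n p) (∧-identityʳ (p n)) ⟩
    allBelow n p ∧ p n
  ∎

allBelow-cong : ∀ n {p q : ℕ → Bool} → (∀ j → j < n → p j ≡ q j) → allBelow n p ≡ allBelow n q
allBelow-cong zero    p≡q = refl
allBelow-cong (suc n) p≡q = cong₂ _∧_ (allBelow-cong n (λ j j<n → p≡q j (m<n⇒m<1+n j<n))) (p≡q n (n<1+n n))

allBelow-true : ∀ n {p : ℕ → Bool} → (∀ j → j < n → p j ≡ true) → allBelow n p ≡ true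
allBelow-true zero    p≡true = refl
allBelow-true (suc n) p≡true =
  cong₂ _∧_ (allBelow-true n (λ j j<n → p≡true j (m<n⇒m<1+n j<n))) (p≡true n (n<1+n n))

allBelow-false : ∀ n {p : ℕ → Bool} i → i < n → p i ≡ false → allBelow n p ≡ false
allBelow-false (suc n) {p} i i<1+n pi≡false with m<1+n⇒m<n∨m≡n i<1+n
... | inj₁ i<n  = cong (_∧ p n) (allBelow-false n i i<n pi≡false)
... | inj₂ refl = trans (cong (allBelow n p ∧_) pi≡false) (∧-zeroʳ (allBelow n p))

-- letter u j = u_{j+1}, the letter at (0-based) index j; 0 beyond the end of u.
letter : List ℕ → ℕ → ℕ
letter []      j       = 0
letter (x ∷ u) zero    = x
letter (x ∷ u) (suc j) = letter u j

length-∷ʳ : ∀ (u : List ℕ) c → length (u ∷ʳ c) ≡ suc (length u)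
length-∷ʳ u c = trans (length-++ u) (+-comm (length u) 1)

length-toList : ∀ {n} (w : Word n) → length (toList w) ≡ n
length-toList []      = refl
length-toList (w ▷ k) = trans (length-∷ʳ (toList w) _) (cong suc (length-toList w))

index-∷ʳ : ∀ (u : List ℕ) c {j} → j < length (u ∷ʳ c) → j < length u ⊎ j ≡ length u
index-∷ʳ u c j<l = m<1+n⇒m<n∨m≡n (subst (_ <_) (length-∷ʳ u c) j<l)

letter-∷ʳ : ∀ (u : List ℕ) c j → j < length u → letter (u ∷ʳ c) j ≡ letter u j
letter-∷ʳ (x ∷ u) c zero    _         = refl
letter-∷ʳ (x ∷ u) c (suc j) (s≤s j<l) = letter-∷ʳ u c j j<l

letter-last : ∀ (u : List ℕ) c → letter (u ∷ʳ c) (length u) ≡ c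
letter-last []      c = refl
letter-last (x ∷ u) c = letter-last u c

take-∷ʳ : ∀ (u : List ℕ) c j → j ≤ length u → take j (u ∷ʳ c) ≡ take j u
take-∷ʳ u       c zero    _         = refl
take-∷ʳ (x ∷ u) c (suc j) (s≤s j≤l) = cong (x ∷_) (take-∷ʳ u c j j≤l)

moveCondition-∷ʳ : ∀ (u : List ℕ) c j → j < length u →
  moveCondition (u ∷ʳ c) j ≡ moveCondition u j ∧ (letter u j <ᵇ c)
moveCondition-∷ʳ (x ∷ u) c zero    _         =
  trans (allᵇ-++ (x <ᵇ_) u [ c ]) (cong (allᵇ (x <ᵇ_) u ∧_) (∧-identityʳ (x <ᵇ c)))
moveCondition-∷ʳ (x ∷ u) c (suc j) (s≤s j<l) = moveCondition-∷ʳ u c j j<l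

moveCondition-last : ∀ (u : List ℕ) c → moveCondition (u ∷ʳ c) (length u) ≡ true
moveCondition-last []      c = refl
moveCondition-last (x ∷ u) c = moveCondition-last u c

winningMove : ℕ → List ℕ → ℕ → Bool
winningMove lo u j = (lo ≤ᵇ j) ∧ moveCondition u j ∧ isKernel lo (take j u)

notWinningFuel : ℕ → ℕ → List ℕ → ℕ → Bool
notWinningFuel lo f u m = not (lo ≤ᵇ m) ∨ not (moveCondition u m) ∨ not (isKernelFuel lo f (take m u))

isKernelFuel-suc : ∀ lo f u → isKernelFuel lo (suc f) u ≡ allBelow (length u) (notWinningFuel lo f u)
isKernelFuel-suc lo f u = allᵇ-upTo (length u) (notWinningFuel lo f u)

take-within : ∀ f m (u : List ℕ) → m < length u → length u ≤ suc f → length (take m u) ≤ f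
take-within f m u m<l l≤f = ≤-trans (≤-reflexive (length-take m u))
                                     (≤-trans (m⊓n≤m m (length u)) (≤-pred (≤-trans m<l l≤f)))

isKernelFuel-stable : ∀ lo f g (u : List ℕ) → length u ≤ f → length u ≤ g →
  isKernelFuel lo f u ≡ isKernelFuel lo g u
isKernelFuel-stable lo zero    zero    u  _ _ = refl
isKernelFuel-stable lo zero    (suc g) [] _ _ = refl
isKernelFuel-stable lo (suc f) zero    [] _ _ = refl
isKernelFuel-stable lo (suc f) (suc g) u  l≤f l≤g = begin
    isKernelFuel lo (suc f) u
  ≡⟨ isKernelFuel-suc lo f u ⟩
    allBelow (length u) (notWinningFuel lo f u)
  ≡⟨ allBelow-cong (length u) (λ m m<l → cong (λ b → not (lo ≤ᵇ m) ∨ not (moveCondition u m) ∨ not b)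
       (isKernelFuel-stable lo f g (take m u) (take-within f m u m<l l≤f) (take-within g m u m<l l≤g))) ⟩
    allBelow (length u) (notWinningFuel lo g u)
  ≡⟨ isKernelFuel-suc lo g u ⟨
    isKernelFuel lo (suc g) u
  ∎

deMorgan₃ : ∀ a b c → not a ∨ not b ∨ not c ≡ not (a ∧ b ∧ c)
deMorgan₃ true  true  c = refl
deMorgan₃ true  false c = refl
deMorgan₃ false b     c = refl

isKernel-winning : ∀ lo (u : List ℕ) → isKernel lo u ≡ allBelow (length u) (λ j → not (winningMove lo u j))
isKernel-winning lo []       = refl
isKernel-winning lo (x ∷ xs) =
  trans (isKernelFuel-suc lo (length xs) (x ∷ xs)) (allBelow-cong (suc (length xs)) no-winning)
  where
  no-winning : ∀ j → j < suc (length xs) → notWinningFuel lo (length xs) (x ∷ xs) j ≡ not (winningMove lo (x ∷ xs) j)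
  no-winning j j<l = trans
    (cong (λ b → not (lo ≤ᵇ j) ∨ not (moveCondition (x ∷ xs) j) ∨ not b)
      (isKernelFuel-stable lo (length xs) _ (take j (x ∷ xs)) (take-within (length xs) j (x ∷ xs) j<l ≤-refl) ≤-refl))
    (deMorgan₃ (lo ≤ᵇ j) (moveCondition (x ∷ xs) j) (isKernel lo (take j (x ∷ xs))))

winningMove-∷ʳ : ∀ lo (u : List ℕ) c j → j < length u →
  winningMove lo (u ∷ʳ c) j ≡ winningMove lo u j ∧ (letter u j <ᵇ c)
winningMove-∷ʳ lo u c j j<l
  rewrite moveCondition-∷ʳ u c j j<l | take-∷ʳ u c j (<⇒≤ j<l) =
  regroup (lo ≤ᵇ j) (moveCondition u j) (letter u j <ᵇ c) (isKernel lo (take j u))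
  where
  regroup : ∀ a b d k → a ∧ (b ∧ d) ∧ k ≡ (a ∧ b ∧ k) ∧ d
  regroup false b d     k = refl
  regroup true  false d k = refl
  regroup true  true  d k = ∧-comm d k

winningMove-last : ∀ lo (u : List ℕ) c → winningMove lo (u ∷ʳ c) (length u) ≡ (lo ≤ᵇ length u) ∧ isKernel lo u
winningMove-last lo u c
  rewrite moveCondition-last u c | take-∷ʳ u c (length u) ≤-refl | take-all (length u) u ≤-refl = refl

-- A state is `nothing` at a kernel position and `just m` at a
-- non-kernel one, where m+1 is the letter following the unique kernel prefix reachable by a
-- move.
step : Bool → Maybe ℕ → ℕ → Maybe ℕ
step allowed nothing  v = if allowed then just v else nothing
step allowed (just m) v = if m <ᵇ v then just m else nothing

-- The automaton state reached after reading a position, for the game with moves to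
-- prefixes of length ≥ lo: the move deleting the letter appended at length n is allowed iff lo ≤ n.
state : ℕ → ∀ {n} → Word n → Maybe ℕ
state lo []              = nothing
state lo {suc n} (w ▷ k) = step (lo ≤ᵇ n) (state lo w) (toℕ k)

record UniqueWin (lo m : ℕ) (u : List ℕ) : Set where
  field
    index    : ℕ
    in-range : index < length u
    next     : letter u index ≡ suc m
    wins     : winningMove lo u index ≡ true
    unique   : ∀ j → j < length u → j ≢ index → winningMove lo u j ≡ false

Tracks : ℕ → Maybe ℕ → List ℕ → Set
Tracks lo nothing  u = ∀ j → j < length u → winningMove lo u j ≡ false
Tracks lo (just m) u = UniqueWin lo m u

tracks-kernel : ∀ lo σ u → Tracks lo σ u → isKernel lo u ≡ is-nothing σ
tracks-kernel lo nothing  u none =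
  trans (isKernel-winning lo u) (allBelow-true (length u) (λ j j<l → cong not (none j j<l)))
tracks-kernel lo (just m) u win =
  trans (isKernel-winning lo u) (allBelow-false (length u) index in-range (cong not wins))
  where open UniqueWin win

losing-∷ʳ : ∀ lo u c j → j < length u → winningMove lo u j ≡ false → winningMove lo (u ∷ʳ c) j ≡ false
losing-∷ʳ lo u c j j<l loses = trans (winningMove-∷ʳ lo u c j j<l) (cong (_∧ (letter u j <ᵇ c)) loses)

tracks-step-nothing : ∀ lo u v → Tracks lo nothing u →
  Tracks lo (step (lo ≤ᵇ length u) nothing v) (u ∷ʳ suc v)
tracks-step-nothing lo u v none with lo ≤ᵇ length u in allowed
... | true  = record
  { index    = length u
  ; in-range = subst (length u <_) (sym (length-∷ʳ u (suc v))) (n<1+n (length u))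
  ; next     = letter-last u (suc v)
  ; wins     = trans (winningMove-last lo u (suc v)) (cong₂ _∧_ allowed (tracks-kernel lo nothing u none))
  ; unique   = λ j j<l j≢l → [ (λ j<l → losing-∷ʳ lo u (suc v) j j<l (none j j<l))
                             , (λ j≡l → contradiction j≡l j≢l) ]′ (index-∷ʳ u (suc v) j<l)
  }
... | false = λ j j<l → [ (λ j<l → losing-∷ʳ lo u (suc v) j j<l (none j j<l))
                        , (λ { refl → trans (winningMove-last lo u (suc v)) (cong (_∧ isKernel lo u) allowed) }) ]′
                        (index-∷ʳ u (suc v) j<l)

module _ {lo m : ℕ} {u : List ℕ} (win : UniqueWin lo m u) where
  open UniqueWin win

  winner-∷ʳ : ∀ v → winningMove lo (u ∷ʳ suc v) index ≡ (m <ᵇ v)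
  winner-∷ʳ v = trans (winningMove-∷ʳ lo u (suc v) index in-range) (cong₂ _∧_ wins (cong (_<ᵇ suc v) next))

  last-loses : ∀ c → winningMove lo (u ∷ʳ c) (length u) ≡ false
  last-loses c = begin
      winningMove lo (u ∷ʳ c) (length u)   ≡⟨ winningMove-last lo u c ⟩
      (lo ≤ᵇ length u) ∧ isKernel lo u     ≡⟨ cong ((lo ≤ᵇ length u) ∧_) (tracks-kernel lo (just m) u win) ⟩
      (lo ≤ᵇ length u) ∧ false             ≡⟨ ∧-zeroʳ (lo ≤ᵇ length u) ⟩
      false                                ∎

  tracks-step-just : ∀ allowed v → Tracks lo (step allowed (just m) v) (u ∷ʳ suc v)
  tracks-step-just allowed v with m <ᵇ v in survives
  ... | true  = record
    { index    = index
    ; in-range = subst (index <_) (sym (length-∷ʳ u (suc v))) (m<n⇒m<1+n in-range)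
    ; next     = trans (letter-∷ʳ u (suc v) index in-range) next
    ; wins     = trans (winner-∷ʳ v) survives
    ; unique   = λ j j<l j≢i → [ (λ j<l → losing-∷ʳ lo u (suc v) j j<l (unique j j<l j≢i))
                               , (λ { refl → last-loses (suc v) }) ]′ (index-∷ʳ u (suc v) j<l)
    }
  ... | false = λ j j<l → [ (old-loses j) , (λ { refl → last-loses (suc v) }) ]′ (index-∷ʳ u (suc v) j<l)
    where
    old-loses : ∀ j → j < length u → winningMove lo (u ∷ʳ suc v) j ≡ false
    old-loses j j<l with j ≟ index
    ... | yes refl = trans (winner-∷ʳ v) survives
    ... | no j≢i   = losing-∷ʳ lo u (suc v) j j<l (unique j j<l j≢i)

tracks-step : ∀ lo σ u v → Tracks lo σ u → Tracks lo (step (lo ≤ᵇ length u) σ v) (u ∷ʳ suc v)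
tracks-step lo nothing  u v = tracks-step-nothing lo u v
tracks-step lo (just m) u v win = tracks-step-just win (lo ≤ᵇ length u) v

tracks-word : ∀ lo {n} (w : Word n) → Tracks lo (state lo w) (toList w)
tracks-word lo []      = λ j ()
tracks-word lo (w ▷ k) =
  subst (λ l → Tracks lo (step (lo ≤ᵇ l) (state lo w) (toℕ k)) (toList w ∷ʳ suc (toℕ k)))
        (length-toList w)
        (tracks-step lo (state lo w) (toList w) (toℕ k) (tracks-word lo w))

kernel-state : ∀ lo {n} (w : Word n) → isKernel lo (toList w) ≡ is-nothing (state lo w)
kernel-state lo w = tracks-kernel lo (state lo w) (toList w) (tracks-word lo w)

accept : Maybe ℕ → ℕ
accept σ = if is-nothing σ then 1 else 0

-- continuations t r σ: the number of ways to extend a position of length t, in state σ, by r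
-- letters (the letter appended at length s being one of 1,…,s+1) so as to reach a kernel
-- position, every move to a nonempty prefix being allowed.
continuations : ℕ → ℕ → Maybe ℕ → ℕ
continuations t zero    σ = accept σ
continuations t (suc r) σ = ∑[ v < suc t ] continuations (suc t) r (step true σ (toℕ v))

fromKernel : ℕ → ℕ → ℕ
fromKernel t r = continuations t r nothing

length-filterᵇ : ∀ {A : Set} (p : A → Bool) xs → length (filterᵇ p xs) ≡ listSum (map (λ x → if p x then 1 else 0) xs)
length-filterᵇ p [] = refl
length-filterᵇ p (x ∷ xs) with p x
... | true  = cong suc (length-filterᵇ p xs)
... | false = length-filterᵇ p xs

sum-map-tabulate : ∀ {A : Set} n (f : Fin n → A) (g : A → ℕ) → listSum (map g (tabulate f)) ≡ ∑[ i < n ] g (f i)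
sum-map-tabulate zero    f g = refl
sum-map-tabulate (suc n) f g = cong (g (f zero) +_) (sum-map-tabulate n (λ i → f (suc i)) g)

sumWords : ∀ n → (Word n → ℕ) → ℕ
sumWords n g = listSum (map g (allWords n))

sumWords-cong : ∀ n {g h : Word n → ℕ} → (∀ w → g w ≡ h w) → sumWords n g ≡ sumWords n h
sumWords-cong n g≡h = cong listSum (map-cong g≡h (allWords n))

sumWords-suc : ∀ n (g : Word (suc n) → ℕ) → sumWords (suc n) g ≡ sumWords n (λ w → ∑[ k < suc n ] g (w ▷ k))
sumWords-suc n g = go (allWords n)
  where
  go : ∀ ws → listSum (map g (concatMap (λ w → map (w ▷_) (allFin (suc n))) ws))
            ≡ listSum (map (λ w → ∑[ k < suc n ] g (w ▷ k)) ws)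
  go []       = refl
  go (w ∷ ws) = begin
      listSum (map g (map (w ▷_) (allFin (suc n)) ++ rest))
    ≡⟨ cong listSum (map-++ g (map (w ▷_) (allFin (suc n))) rest) ⟩
      listSum (map g (map (w ▷_) (allFin (suc n))) ++ map g rest)
    ≡⟨ sum-++ (map g (map (w ▷_) (allFin (suc n)))) (map g rest) ⟩
      listSum (map g (map (w ▷_) (allFin (suc n)))) + listSum (map g rest)
    ≡⟨ cong (_+ listSum (map g rest)) (cong listSum (map-∘ (allFin (suc n)))) ⟨
      listSum (map (λ k → g (w ▷ k)) (allFin (suc n))) + listSum (map g rest)
    ≡⟨ cong₂ _+_ (sum-map-tabulate (suc n) (λ k → k) (λ k → g (w ▷ k))) (go ws) ⟩
      ∑[ k < suc n ] g (w ▷ k) + listSum (map (λ w → ∑[ k < suc n ] g (w ▷ k)) ws)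
    ∎
    where rest = concatMap (λ w → map (w ▷_) (allFin (suc n))) ws

-- Reading the letters beyond length n ≥ lo, every move deleting them is allowed, so the kernel
-- positions of rank n+r are counted by the continuations of the positions of rank n.
sumWords-continuations : ∀ lo r n → lo ≤ n →
  sumWords n (λ w → continuations n r (state lo w)) ≡ sumWords (n + r) (λ w → accept (state lo w))
sumWords-continuations lo zero    n lo≤n = sym (cong (λ l → sumWords l (λ w → accept (state lo w))) (+-identityʳ n))
sumWords-continuations lo (suc r) n lo≤n = begin
    sumWords n (λ w → ∑[ k < suc n ] continuations (suc n) r (step true (state lo w) (toℕ k)))
  ≡⟨ sumWords-cong n (λ w → cong (λ b → ∑[ k < suc n ] continuations (suc n) r (step b (state lo w) (toℕ k)))
                                 (sym allowed)) ⟩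
    sumWords n (λ w → ∑[ k < suc n ] continuations (suc n) r (state lo (w ▷ k)))
  ≡⟨ sumWords-suc n (λ w → continuations (suc n) r (state lo w)) ⟨
    sumWords (suc n) (λ w → continuations (suc n) r (state lo w))
  ≡⟨ sumWords-continuations lo r (suc n) (m≤n⇒m≤1+n lo≤n) ⟩
    sumWords (suc n + r) (λ w → accept (state lo w))
  ≡⟨ cong (λ l → sumWords l (λ w → accept (state lo w))) (+-suc n r) ⟨
    sumWords (n + suc r) (λ w → accept (state lo w))
  ∎
  where
  allowed : (lo ≤ᵇ n) ≡ true
  allowed = Equivalence.to T-≡ (≤⇒≤ᵇ lo≤n)

kernelCount-accept : ∀ lo n → kernelCount lo n ≡ sumWords n (λ w → accept (state lo w))
kernelCount-accept lo n = trans (length-filterᵇ _ (allWords n))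
  (sumWords-cong n (λ w → cong (λ b → if b then 1 else 0) (kernel-state lo w)))

κEF-fromKernel : ∀ n → κEF n ≡ fromKernel 0 n
κEF-fromKernel n = begin
    κEF n                                                   ≡⟨ kernelCount-accept 0 n ⟩
    sumWords n (λ w → accept (state 0 w))                   ≡⟨ sumWords-continuations 0 n 0 z≤n ⟨
    sumWords 0 (λ w → continuations 0 n (state 0 w))        ≡⟨ +-identityʳ (fromKernel 0 n) ⟩
    fromKernel 0 n                                          ∎

-- In the flat Bernoulli game, rank-(n+1) kernel positions are the continuations of the word 1,
-- the move to the empty word being forbidden.
κ-fromKernel : ∀ n → κ (suc n) ≡ fromKernel 1 n
κ-fromKernel n = begin
    κ (suc n)                                               ≡⟨ kernelCount-accept 1 (suc n) ⟩
    sumWords (suc n) (λ w → accept (state 1 w))             ≡⟨ sumWords-continuations 1 n 1 ≤-refl ⟨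
    sumWords 1 (λ w → continuations 1 n (state 1 w))        ≡⟨ +-identityʳ (fromKernel 1 n) ⟩
    fromKernel 1 n                                          ∎

weighted : ℕ → ℕ → ℕ → ℕ
weighted k t r = ∑[ m < t ] (((t ∸ suc (toℕ m)) C k) * continuations t r (just (toℕ m)))

continuations-just : ∀ t r m → m ≤ t →
  continuations t (suc r) (just m) ≡ (t ∸ m) * continuations (suc t) r (just m) + suc m * fromKernel (suc t) r
continuations-just t r m m≤t = begin
    ∑[ v < suc t ] continuations (suc t) r (if m <ᵇ toℕ v then just m else nothing)
  ≡⟨ sum-cong-≗ {suc t} (λ v → if-float (continuations (suc t) r) (m <ᵇ toℕ v) {just m} {nothing}) ⟩
    ∑[ v < suc t ] (if m <ᵇ toℕ v then continuations (suc t) r (just m) else fromKernel (suc t) r)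
  ≡⟨ ∑-threshold _ _ m≤t ⟩
    (t ∸ m) * continuations (suc t) r (just m) + suc m * fromKernel (suc t) r
  ∎

fromKernel-suc : ∀ t r → fromKernel t (suc r) ≡ weighted 0 (suc t) r
fromKernel-suc t r = sum-cong-≗ {suc t} (λ m → sym (*-identityˡ (continuations (suc t) r (just (toℕ m)))))

-- The contribution of state m to `weighted k t` after one more letter: by absorption, the
-- part that stays in state m is a multiple of the weight used in `weighted (k+1) (t+1)`.
weighted-term : ∀ k t r m → m < t →
  ((t ∸ suc m) C k) * continuations t (suc r) (just m)
    ≡ suc k * (((t ∸ m) C suc k) * continuations (suc t) r (just m))
      + (((t ∸ suc m) C k) * suc m) * fromKernel (suc t) r
weighted-term k t r m m<t = begin
    c * continuations t (suc r) (just m)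
  ≡⟨ cong (c *_) (continuations-just t r m (<⇒≤ m<t)) ⟩
    c * ((t ∸ m) * A + suc m * B)
  ≡⟨ cong (λ d → c * (d * A + suc m * B)) t∸m≡1+x ⟩
    c * (suc x * A + suc m * B)
  ≡⟨ distribute c (suc x) A (suc m) B ⟩
    (c * suc x) * A + (c * suc m) * B
  ≡⟨ cong (λ d → d * A + (c * suc m) * B) (absorption x k) ⟩
    (suc k * (suc x C suc k)) * A + (c * suc m) * B
  ≡⟨ cong (_+ (c * suc m) * B) (*-assoc (suc k) (suc x C suc k) A) ⟩
    suc k * ((suc x C suc k) * A) + (c * suc m) * B
  ≡⟨ cong (λ d → suc k * ((d C suc k) * A) + (c * suc m) * B) t∸m≡1+x ⟨
    suc k * (((t ∸ m) C suc k) * A) + (c * suc m) * B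
  ∎
  where
  x = t ∸ suc m
  c = x C k
  A = continuations (suc t) r (just m)
  B = fromKernel (suc t) r
  t∸m≡1+x : t ∸ m ≡ suc x
  t∸m≡1+x = +-∸-assoc 1 m<t
  distribute : ∀ c p a q b → c * (p * a + q * b) ≡ (c * p) * a + (c * q) * b
  distribute = solve-∀

-- The last state m = t does not contribute to weighted (k+1) (t+1): its weight is (0 choose k+1) = 0.
weighted-init : ∀ k t r →
  weighted (suc k) (suc t) r ≡ ∑[ m < t ] (((t ∸ toℕ m) C suc k) * continuations (suc t) r (just (toℕ m)))
weighted-init k t r = begin
    ∑[ m < suc t ] g (toℕ m)
  ≡⟨ sum-init-last {t} (λ m → g (toℕ m)) ⟩
    ∑[ m < t ] g (toℕ (inject₁ m)) + g (toℕ (fromℕ t))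
  ≡⟨ cong₂ _+_ (sum-cong-≗ {t} (λ m → cong g (toℕ-inject₁ m))) last-vanishes ⟩
    ∑[ m < t ] g (toℕ m) + 0
  ≡⟨ +-identityʳ _ ⟩
    ∑[ m < t ] g (toℕ m)
  ∎
  where
  g : ℕ → ℕ
  g j = ((t ∸ j) C suc k) * continuations (suc t) r (just j)
  last-vanishes : g (toℕ (fromℕ t)) ≡ 0
  last-vanishes rewrite toℕ-fromℕ t | n∸n≡0 t = refl

weighted-suc : ∀ k t r →
  weighted k t (suc r) ≡ suc k * weighted (suc k) (suc t) r + (suc t C suc (suc k)) * fromKernel (suc t) r
weighted-suc k t r = begin
    ∑[ m < t ] (c m * continuations t (suc r) (just (toℕ m)))
  ≡⟨ sum-cong-≗ {t} (λ m → weighted-term k t r (toℕ m) (toℕ<n m)) ⟩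
    ∑[ m < t ] (suc k * P m + Q m * B)
  ≡⟨ ∑-distrib-+ (λ m → suc k * P m) (λ m → Q m * B) ⟩
    ∑[ m < t ] (suc k * P m) + ∑[ m < t ] (Q m * B)
  ≡⟨ cong₂ _+_ (*-distribˡ-sum (suc k) P) (*-distribʳ-sum B Q) ⟨
    suc k * ∑[ m < t ] P m + ∑[ m < t ] Q m * B
  ≡⟨ cong₂ (λ p q → suc k * p + q * B) (sym (weighted-init k t r)) (weighted-hockey-stick k t) ⟩
    suc k * weighted (suc k) (suc t) r + (suc t C suc (suc k)) * B
  ∎
  where
  c P Q : Fin t → ℕ
  c m = (t ∸ suc (toℕ m)) C k
  P m = ((t ∸ toℕ m) C suc k) * continuations (suc t) r (just (toℕ m))
  Q m = c m * suc (toℕ m)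
  B = fromKernel (suc t) r

mutual
  -- K r = fromKernel t r / (t+r choose r), which turns out to be independent of t.
  K : ℕ → ℕ
  K zero    = 1
  K (suc r) = L 0 r

  -- L k r = weighted k t r / (t+r choose k+r+1), likewise independent of t.
  L : ℕ → ℕ → ℕ
  L k zero    = 0
  L k (suc r) = suc k * L (suc k) r + ((r + suc (suc k)) C r) * K r

revision : ∀ t k r →
  (suc t C suc (suc k)) * (suc (t + r) C r) ≡ (suc (t + r) C suc (suc (k + r))) * ((r + suc (suc k)) C r)
revision t k r = begin
    (suc t C suc (suc k)) * (suc (t + r) C r)
  ≡⟨ *-comm (suc t C suc (suc k)) (suc (t + r) C r) ⟩
    (suc (t + r) C r) * (suc t C suc (suc k))
  ≡⟨ cong (λ n → (n C r) * (suc t C suc (suc k))) shift-t ⟩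
    ((r + suc t) C r) * (suc t C suc (suc k))
  ≡⟨ trinomial r (suc t) (suc (suc k)) ⟩
    ((r + suc t) C (r + suc (suc k))) * ((r + suc (suc k)) C r)
  ≡⟨ cong₂ (λ n j → (n C j) * ((r + suc (suc k)) C r)) shift-t shift-k ⟨
    (suc (t + r) C suc (suc (k + r))) * ((r + suc (suc k)) C r)
  ∎
  where
  shift-t : suc (t + r) ≡ r + suc t
  shift-t = trans (cong suc (+-comm t r)) (sym (+-suc r t))
  shift-k : suc (suc (k + r)) ≡ r + suc (suc k)
  shift-k = trans (cong (suc ∘′ suc) (+-comm k r)) (sym (trans (+-suc r (suc k)) (cong suc (+-suc r k))))

mutual
  fromKernel-closed : ∀ r t → fromKernel t r ≡ ((t + r) C r) * K r
  fromKernel-closed zero    t = refl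
  fromKernel-closed (suc r) t = begin
      fromKernel t (suc r)
    ≡⟨ fromKernel-suc t r ⟩
      weighted 0 (suc t) r
    ≡⟨ weighted-closed r 0 (suc t) ⟩
      (suc (t + r) C suc r) * K (suc r)
    ≡⟨ cong (λ n → (n C suc r) * K (suc r)) (+-suc t r) ⟨
      ((t + suc r) C suc r) * K (suc r)
    ∎

  weighted-closed : ∀ r k t → weighted k t r ≡ ((t + r) C suc (k + r)) * L k r
  weighted-closed zero k t = begin
      ∑[ m < t ] (((t ∸ suc (toℕ m)) C k) * 0)
    ≡⟨ sum-cong-≗ {t} (λ m → *-zeroʳ ((t ∸ suc (toℕ m)) C k)) ⟩
      ∑[ m < t ] 0
    ≡⟨ ∑-const t 0 ⟩
      t * 0
    ≡⟨ *-zeroʳ t ⟩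
      0
    ≡⟨ *-zeroʳ ((t + 0) C suc (k + 0)) ⟨
      ((t + 0) C suc (k + 0)) * 0
    ∎
  weighted-closed (suc r) k t = begin
      weighted k t (suc r)
    ≡⟨ weighted-suc k t r ⟩
      suc k * weighted (suc k) (suc t) r + w * fromKernel (suc t) r
    ≡⟨ cong₂ (λ p q → suc k * p + w * q) (weighted-closed r (suc k) (suc t)) (fromKernel-closed r (suc t)) ⟩
      suc k * (X * L (suc k) r) + w * (y * K r)
    ≡⟨ cong (suc k * (X * L (suc k) r) +_) (*-assoc w y (K r)) ⟨
      suc k * (X * L (suc k) r) + (w * y) * K r
    ≡⟨ cong (λ p → suc k * (X * L (suc k) r) + p * K r) (revision t k r) ⟩
      suc k * (X * L (suc k) r) + (X * z) * K r
    ≡⟨ factor X (L (suc k) r) z (K r) k ⟩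
      X * L k (suc r)
    ≡⟨ cong₂ (λ n j → (n C suc j) * L k (suc r)) (+-suc t r) (+-suc k r) ⟨
      ((t + suc r) C suc (k + suc r)) * L k (suc r)
    ∎
    where
    w = suc t C suc (suc k)
    y = suc (t + r) C r
    z = (r + suc (suc k)) C r
    X = suc (t + r) C suc (suc (k + r))
    factor : ∀ X d z e k → suc k * (X * d) + (X * z) * e ≡ X * (suc k * d + z * e)
    factor = solve-∀

fromKernel-shift : ∀ n → fromKernel 1 n ≡ suc n * fromKernel 0 n
fromKernel-shift n = begin
    fromKernel 1 n             ≡⟨ fromKernel-closed n 1 ⟩
    ((1 + n) C n) * K n        ≡⟨ cong (_* K n) ([1+n]Cn≡1+n n) ⟩
    suc n * K n                ≡⟨ cong (suc n *_) (*-identityˡ (K n)) ⟨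
    suc n * (1 * K n)          ≡⟨ cong (λ c → suc n * (c * K n)) (nCn≡1 n) ⟨
    suc n * ((n C n) * K n)    ≡⟨ cong (suc n *_) (fromKernel-closed n 0) ⟨
    suc n * fromKernel 0 n     ∎

proposition6p7 : (n : ℕ) → κ (suc n) ≡ suc n * κEF n
proposition6p7 n = begin
  κ (suc n)               ≡⟨ κ-fromKernel n ⟩
  fromKernel 1 n          ≡⟨ fromKernel-shift n ⟩
  suc n * fromKernel 0 n  ≡⟨ cong (suc n *_) (κEF-fromKernel n) ⟨
  suc n * κEF n           ∎
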